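{- For all $n\geq1$, $$\sum_{i=1}^{2n}B_{2i-1}=\left(\frac{20B_{n+1}^{neobc}-7C_{n+1}^{neobc}-15}{6}\right)^{2},\qquad 1+\sum_{i=1}^{4n+2}c_{i}=\left(\frac{4R_{n+1}^{neobc}+5}{3}\right)^{2},$$ $$1+\sum_{i=1}^{8n-5}P_{i}=\left(\frac{ -4B_{n}^{neobc}+2C_{n}^{neobc}+3}{3}\right)^{2},\qquad \sum_{i=1}^{4n}Q_{2i-1}=\left(\frac{40B_{n+1}^{neobc}-14C_{n+1}^{neobc}-30}{3}\right)^{2},$$ $$\frac{1}{2}\sum_{i=0}^{4n}Q_{2i+1}=\left(\frac{12B_{n+1}^{neobc}-4C_{n+1}^{neobc}-9}{3}\right)^{2}.$$
   Context: Let $\alpha=1+\sqrt2$, $\beta=1-\sqrt2$. Balancing numbers $B_k=\frac{\alpha^{2k}-\beta^{2k}}{4\sqrt2}$; Lucas-cobalancing numbers $c_k=\frac{\alpha^{2k-1}+\beta^{2k-1}}{2}$ ($k\ge1$; so $c_1=1,c_2=7$); Pell numbers $P_0=0,P_1=1,P_k=2P_{k-1}+P_{k-2}$; Pell-Lucas numbers $Q_0=Q_1=2,Q_k=2Q_{k-1}+Q_{k-2}$. A positive integer $m$ is a neo balcobalancing number if there is a positive integer $r$ (its neo balcobalancer) such that $(1+2+\cdots+(m-1))+(1+2+\cdots+m)=2[(m-1)+m+(m+1)+(m+2)+\cdots+(m+r)]$; then $r=\frac{ -2m-1+\sqrt{8m^2-12m+9}}{2}$ (equivalently, $m$ is a neo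 balcobalancing number iff $8m^2-12m+9$ is a perfect square). $B_n^{neobc}$ denotes the $n$-th neo balcobalancing number in increasing order ($n\ge1$), $R_n^{neobc}$ its neo balcobalancer and $C_n^{neobc}=\sqrt{8(B_n^{neobc})^2-12B_n^{neobc}+9}$. -}

module Defs where

open import Data.Nat as ℕ using (ℕ; zero; suc; _∸_; _≤_; _<_)
open import Data.Integer as ℤ using (ℤ; +_; _-_; _*_)
import Data.Integer
open import Data.List using (List; applyUpTo; map; length)
import Data.List as List
open import Data.List.Membership.Propositional using (_∈_)
open import Data.List.Relation.Unary.Unique.Propositional using (Unique)
open import Data.Product using (Σ; ∃; _×_)
open import Relation.Binary.PropositionalEquality using (_≡_)

range : ℕ → ℕ → List ℕ
range lo hi = applyUpTo (lo ℕ.+_) (suc hi ∸ lo)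

∑ : ℕ → ℕ → (ℕ → ℤ) → ℤ
∑ lo hi f = List.foldr ℤ._+_ (+ 0) (map f (range lo hi))

∑ℕid : ℕ → ℕ → ℕ
∑ℕid lo hi = List.foldr ℕ._+_ 0 (range lo hi)

-- Sequences (integer-valued, defined by their standard recurrences,
-- which agree with the Binet formulas of the paper).

B : ℕ → ℤ
B zero = + 0
B (suc zero) = + 1
B (suc (suc k)) = + 6 * B (suc k) - B k

-- Lucas-cobalancing numbers, indexed from 1: c 1 = 1, c 2 = 7,
-- c (k+2) = 6 c (k+1) - c k.  (c 0 is set to the value 1 forced by the
-- Binet formula at k = 0, i.e. (α⁻¹ + β⁻¹)/2 = 1; it is never used.)
c : ℕ → ℤ
c zero = + 1
c (suc zero) = + 1
c (suc (suc zero)) = + 7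
c (suc (suc (suc k))) = + 6 * c (suc (suc k)) - c (suc k)

P : ℕ → ℤ
P zero = + 0
P (suc zero) = + 1
P (suc (suc k)) = + 2 * P (suc k) ℤ.+ P k

Q : ℕ → ℤ
Q zero = + 2
Q (suc zero) = + 2
Q (suc (suc k)) = + 2 * Q (suc k) ℤ.+ Q k

IsNeoBalcobalancer : ℕ → ℕ → Set
IsNeoBalcobalancer m r =
  1 ≤ m × 1 ≤ r ×
  (∑ℕid 1 (m ∸ 1) ℕ.+ ∑ℕid 1 m ≡ 2 ℕ.* ∑ℕid (m ∸ 1) (m ℕ.+ r))

IsNeoBC : ℕ → Set
IsNeoBC m = ∃ λ r → IsNeoBalcobalancer m r

IsNthNeoBC : ℕ → ℕ → Set
IsNthNeoBC n m =
  IsNeoBC m ×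
  Σ (List ℕ) λ xs →
    Unique xs × length xs ≡ n ∸ 1 ×
    (∀ k → (k ∈ xs → k < m × IsNeoBC k) × (k < m → IsNeoBC k → k ∈ xs))

-- C = sqrt(8 m² - 12 m + 9) (the nonnegative square root, as a natural)
IsNeoC : ℕ → ℕ → Set
IsNeoC m C = + C * + C ≡ + 8 * + m * + m - + 12 * + m ℤ.+ + 9

-- A natural m with C = √(8m² − 12m + 9) is a neo balcobalancing number iff (4m − 3)² − 2C² = −9.
-- Multiplication by the unit 17 + 12√2 acts on these solutions, and a descent along its inverse shows
-- that the solutions with m ≥ 1 are exactly 4b − 3 + C√2 = 3(1 + √2)^(4k+3), the k-th one being the
-- (k+1)-st neo balcobalancing number.  On the other side, every sum in the theorem telescopes to
-- q(2g) ± 1 for a suitable g, where (1 + √2)ᵍ = q g + p g √2, and the double-angle formula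
-- q(2g) = q g² + 2 p g² together with the norm q g² − 2 p g² = (−1)ᵍ turns this into 4 p g² or 2 q g².
-- Finally each linear form in b and C is 3 p g or 3 q g; e.g. 20b − 7C − 15 = 3(5 q(g+3) − 7 p(g+3))
-- = 3 p g, as (1 + √2)⁻³ = 5√2 − 7.

module Submission where

open import Defs

module Pell where

  open import Data.Nat using (ℕ; zero; suc)
  import Data.Nat as ℕ
  import Data.Nat.Properties as ℕ
  import Data.Nat.Tactic.RingSolver as ℕ-Solver
  open import Data.Integer using (ℤ; +_; _+_; _-_; _*_; -_)
  import Data.Integer.Properties as ℤ
  open import Data.Integer.Tactic.RingSolver using (solve-∀)
  open import Data.List using (applyUpTo; map; foldr)
  open import Data.Product using (_×_; _,_; proj₁)
  open import Function.Base using (_∘_)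
  open import Relation.Binary.PropositionalEquality using (_≡_; refl; sym; trans; cong; cong₂; module ≡-Reasoning)
  open ≡-Reasoning

  -- (1 + √2)ᵏ = q k + p k √2
  mutual
    q : ℕ → ℤ
    q zero    = + 1
    q (suc k) = q k + + 2 * p k

    p : ℕ → ℤ
    p zero    = + 0
    p (suc k) = q k + p k

  mutual
    q-+ : ∀ t u → q (t ℕ.+ u) ≡ q t * q u + + 2 * (p t * p u)
    q-+ zero    u = base (q u) (p u)
      where
      base : ∀ a b → a ≡ + 1 * a + + 2 * (+ 0 * b)
      base = solve-∀
    q-+ (suc t) u = begin
      q (t ℕ.+ u) + + 2 * p (t ℕ.+ u)                               ≡⟨ cong₂ (λ x y → x + + 2 * y) (q-+ t u) (p-+ t u) ⟩
      q t * q u + + 2 * (p t * p u) + + 2 * (p t * q u + q t * p u) ≡⟨ step (q t) (p t) (q u) (p u) ⟩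
      (q t + + 2 * p t) * q u + + 2 * ((q t + p t) * p u)           ∎
      where
      step : ∀ a b c d → a * c + + 2 * (b * d) + + 2 * (b * c + a * d) ≡ (a + + 2 * b) * c + + 2 * ((a + b) * d)
      step = solve-∀

    p-+ : ∀ t u → p (t ℕ.+ u) ≡ p t * q u + q t * p u
    p-+ zero    u = base (q u) (p u)
      where
      base : ∀ a b → b ≡ + 0 * a + + 1 * b
      base = solve-∀
    p-+ (suc t) u = begin
      q (t ℕ.+ u) + p (t ℕ.+ u)                                 ≡⟨ cong₂ _+_ (q-+ t u) (p-+ t u) ⟩
      q t * q u + + 2 * (p t * p u) + (p t * q u + q t * p u)   ≡⟨ step (q t) (p t) (q u) (p u) ⟩
      (q t + p t) * q u + (q t + + 2 * p t) * p u               ∎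
      where
      step : ∀ a b c d → a * c + + 2 * (b * d) + (b * c + a * d) ≡ (a + b) * c + (a + + 2 * b) * d
      step = solve-∀

  pell-norm : ℕ → ℤ
  pell-norm g = q g * q g - + 2 * (p g * p g)

  pell-norm-2+ : ∀ g → pell-norm (2 ℕ.+ g) ≡ pell-norm g
  pell-norm-2+ g = periodic (q g) (p g)
    where
    periodic : ∀ a b → let a₁ = a + + 2 * b; b₁ = a + b; a₂ = a₁ + + 2 * b₁; b₂ = a₁ + b₁ in
               a₂ * a₂ - + 2 * (b₂ * b₂) ≡ a * a - + 2 * (b * b)
    periodic = solve-∀

  pell-norm-suc : ∀ g → pell-norm (suc g) ≡ - pell-norm g
  pell-norm-suc g = alternating (q g) (p g)
    where
    alternating : ∀ a b → (a + + 2 * b) * (a + + 2 * b) - + 2 * ((a + b) * (a + b)) ≡ - (a * a - + 2 * (b * b))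
    alternating = solve-∀

  pell-norm-4* : ∀ n → pell-norm (4 ℕ.* n) ≡ + 1
  pell-norm-4* zero    = refl
  pell-norm-4* (suc n) = begin
    pell-norm (4 ℕ.* suc n)       ≡⟨ cong pell-norm (ℕ.*-suc 4 n) ⟩
    pell-norm (2 ℕ.+ (2 ℕ.+ 4 ℕ.* n)) ≡⟨ pell-norm-2+ (2 ℕ.+ 4 ℕ.* n) ⟩
    pell-norm (2 ℕ.+ 4 ℕ.* n)     ≡⟨ pell-norm-2+ (4 ℕ.* n) ⟩
    pell-norm (4 ℕ.* n)           ≡⟨ pell-norm-4* n ⟩
    + 1                           ∎

  q-double-sub-norm : ∀ g → q (g ℕ.+ g) - pell-norm g ≡ + 4 * (p g * p g)
  q-double-sub-norm g = trans (cong (_- pell-norm g) (q-+ g g)) (double (q g) (p g))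
    where
    double : ∀ a b → a * a + + 2 * (b * b) - (a * a - + 2 * (b * b)) ≡ + 4 * (b * b)
    double = solve-∀

  q-double-add-norm : ∀ g → q (g ℕ.+ g) + pell-norm g ≡ + 2 * (q g * q g)
  q-double-add-norm g = trans (cong (_+ pell-norm g) (q-+ g g)) (double (q g) (p g))
    where
    double : ∀ a b → a * a + + 2 * (b * b) + (a * a - + 2 * (b * b)) ≡ + 2 * (a * a)
    double = solve-∀

  q-stride : ∀ x → q (4 ℕ.+ x) ≡ + 6 * q (2 ℕ.+ x) - q x
  q-stride x = begin
    q (4 ℕ.+ x)                         ≡⟨ q-+ 4 x ⟩
    q 4 * q x + + 2 * (p 4 * p x)       ≡⟨ stride (q x) (p x) ⟩
    + 6 * (q 2 * q x + + 2 * (p 2 * p x)) - q x ≡⟨ cong (λ y → + 6 * y - q x) (q-+ 2 x) ⟨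
    + 6 * q (2 ℕ.+ x) - q x             ∎
    where
    stride : ∀ a b → + 17 * a + + 2 * (+ 12 * b) ≡ + 6 * (+ 3 * a + + 2 * (+ 2 * b)) - a
    stride = solve-∀

  p-stride : ∀ x → p (4 ℕ.+ x) ≡ + 6 * p (2 ℕ.+ x) - p x
  p-stride x = begin
    p (4 ℕ.+ x)                         ≡⟨ p-+ 4 x ⟩
    p 4 * q x + q 4 * p x               ≡⟨ stride (q x) (p x) ⟩
    + 6 * (p 2 * q x + q 2 * p x) - p x ≡⟨ cong (λ y → + 6 * y - p x) (p-+ 2 x) ⟨
    + 6 * p (2 ℕ.+ x) - p x             ∎
    where
    stride : ∀ a b → + 12 * a + + 17 * b ≡ + 6 * (+ 2 * a + + 3 * b) - b
    stride = solve-∀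

  recurrence-unique : ∀ {A : Set} (step : A → A → A) {u v : ℕ → A} → u 0 ≡ v 0 → u 1 ≡ v 1 →
                      (∀ k → u (2 ℕ.+ k) ≡ step (u (1 ℕ.+ k)) (u k)) →
                      (∀ k → v (2 ℕ.+ k) ≡ step (v (1 ℕ.+ k)) (v k)) →
                      ∀ k → u k ≡ v k
  recurrence-unique step {u} {v} u₀ u₁ u-rec v-rec k = proj₁ (consecutive k)
    where
    consecutive : ∀ k → u k ≡ v k × u (1 ℕ.+ k) ≡ v (1 ℕ.+ k)
    consecutive zero    = u₀ , u₁
    consecutive (suc k) with uₖ , uₖ₊₁ ← consecutive k =
      uₖ₊₁ , trans (u-rec k) (trans (cong₂ step uₖ₊₁ uₖ) (sym (v-rec k)))

  even-stride : ∀ (f : ℕ → ℤ) → (∀ x → f (4 ℕ.+ x) ≡ + 6 * f (2 ℕ.+ x) - f x) →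
                ∀ j k → f (j ℕ.+ 2 ℕ.* (2 ℕ.+ k)) ≡ + 6 * f (j ℕ.+ 2 ℕ.* (1 ℕ.+ k)) - f (j ℕ.+ 2 ℕ.* k)
  even-stride f stride j k = begin
    f (j ℕ.+ 2 ℕ.* (2 ℕ.+ k))                    ≡⟨ cong f (four j k) ⟩
    f (4 ℕ.+ (j ℕ.+ 2 ℕ.* k))                    ≡⟨ stride (j ℕ.+ 2 ℕ.* k) ⟩
    + 6 * f (2 ℕ.+ (j ℕ.+ 2 ℕ.* k)) - f (j ℕ.+ 2 ℕ.* k) ≡⟨ cong (λ i → + 6 * f i - f (j ℕ.+ 2 ℕ.* k)) (two j k) ⟨
    + 6 * f (j ℕ.+ 2 ℕ.* (1 ℕ.+ k)) - f (j ℕ.+ 2 ℕ.* k) ∎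
    where
    four : ∀ j k → j ℕ.+ 2 ℕ.* (2 ℕ.+ k) ≡ 4 ℕ.+ (j ℕ.+ 2 ℕ.* k)
    four = ℕ-Solver.solve-∀
    two : ∀ j k → j ℕ.+ 2 ℕ.* (1 ℕ.+ k) ≡ 2 ℕ.+ (j ℕ.+ 2 ℕ.* k)
    two = ℕ-Solver.solve-∀

  P≡p : ∀ k → P k ≡ p k
  P≡p = recurrence-unique (λ x y → + 2 * x + y) refl refl (λ _ → refl) (λ k → pell (q k) (p k))
    where
    pell : ∀ a b → (a + + 2 * b) + (a + b) ≡ + 2 * (a + b) + b
    pell = solve-∀

  Q≡2q : ∀ k → Q k ≡ + 2 * q k
  Q≡2q = recurrence-unique (λ x y → + 2 * x + y) refl refl (λ _ → refl) (λ k → pell (q k) (p k))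
    where
    pell : ∀ a b → + 2 * ((a + + 2 * b) + + 2 * (a + b)) ≡ + 2 * (+ 2 * (a + + 2 * b)) + + 2 * a
    pell = solve-∀

  2B≡p[2k] : ∀ k → + 2 * B k ≡ p (2 ℕ.* k)
  2B≡p[2k] = recurrence-unique (λ x y → + 6 * x - y) refl refl
    (λ k → balancing (B (suc k)) (B k)) (even-stride p p-stride 0)
    where
    balancing : ∀ x y → + 2 * (+ 6 * x - y) ≡ + 6 * (+ 2 * x) - + 2 * y
    balancing = solve-∀

  c≡q[1+2k] : ∀ k → c (suc k) ≡ q (suc (2 ℕ.* k))
  c≡q[1+2k] = recurrence-unique (λ x y → + 6 * x - y) refl refl (λ _ → refl) (even-stride q q-stride 1)

  telescope : ∀ (k : ℤ) (f g : ℕ → ℤ) (ix : ℕ → ℕ) n → (∀ i → k * f (ix i) ≡ g (suc i) - g i) →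
              k * foldr _+_ (+ 0) (map f (applyUpTo ix n)) ≡ g n - g 0
  telescope k f g ix zero    _    = cancel k (g 0)
    where
    cancel : ∀ k x → k * + 0 ≡ x - x
    cancel = solve-∀
  telescope k f g ix (suc n) step = begin
    k * (f (ix 0) + S)               ≡⟨ ℤ.*-distribˡ-+ k (f (ix 0)) S ⟩
    k * f (ix 0) + k * S             ≡⟨ cong₂ _+_ (step 0) (telescope k f (g ∘ suc) (ix ∘ suc) n (step ∘ suc)) ⟩
    (g 1 - g 0) + (g (suc n) - g 1)  ≡⟨ collapse (g 0) (g 1) (g (suc n)) ⟩
    g (suc n) - g 0                  ∎
    where
    S = foldr _+_ (+ 0) (map f (applyUpTo (ix ∘ suc) n))
    collapse : ∀ x y z → (y - x) + (z - y) ≡ z - x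
    collapse = solve-∀

  ∑-telescope : ∀ lo hi (k : ℤ) (f g : ℕ → ℤ) → (∀ i → k * f (lo ℕ.+ i) ≡ g (suc i) - g i) →
                k * ∑ lo hi f ≡ g (suc hi ℕ.∸ lo) - g 0
  ∑-telescope lo hi k f g = telescope k f g (lo ℕ.+_) (suc hi ℕ.∸ lo)

  q-suc-sub : ∀ x → q (suc x) - q x ≡ + 2 * p x
  q-suc-sub x = step (q x) (p x)
    where
    step : ∀ a b → a + + 2 * b - a ≡ + 2 * b
    step = solve-∀

  q-2+-sub : ∀ x → q (2 ℕ.+ x) - q x ≡ + 2 * q (suc x)
  q-2+-sub x = step (q x) (p x)
    where
    step : ∀ a b → (a + + 2 * b) + + 2 * (a + b) - a ≡ + 2 * (a + + 2 * b)
    step = solve-∀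

  q-4+-sub : ∀ x → q (4 ℕ.+ x) - q x ≡ + 8 * p (2 ℕ.+ x)
  q-4+-sub x = begin
    q (4 ℕ.+ x) - q x                    ≡⟨ cong (_- q x) (q-+ 4 x) ⟩
    q 4 * q x + + 2 * (p 4 * p x) - q x  ≡⟨ step (q x) (p x) ⟩
    + 8 * (p 2 * q x + q 2 * p x)        ≡⟨ cong (+ 8 *_) (p-+ 2 x) ⟨
    + 8 * p (2 ℕ.+ x)                    ∎
    where
    step : ∀ a b → + 17 * a + + 2 * (+ 12 * b) - a ≡ + 8 * (+ 2 * a + + 3 * b)
    step = solve-∀

  q-even-step : ∀ i → q (2 ℕ.* suc i) - q (2 ℕ.* i) ≡ + 2 * q (suc (2 ℕ.* i))
  q-even-step i = trans (cong (λ j → q j - q (2 ℕ.* i)) (ℕ.*-suc 2 i)) (q-2+-sub (2 ℕ.* i))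

  2*suc∸1 : ∀ i → 2 ℕ.* suc i ℕ.∸ 1 ≡ suc (2 ℕ.* i)
  2*suc∸1 i = cong (ℕ._∸ 1) (ℕ.*-suc 2 i)

  sum-B : ∀ M → + 16 * ∑ 1 M (λ i → B (2 ℕ.* i ℕ.∸ 1)) ≡ q (4 ℕ.* M) - + 1
  sum-B M = ∑-telescope 1 M (+ 16) _ (λ i → q (4 ℕ.* i)) step
    where
    index : ∀ i → 2 ℕ.* suc (2 ℕ.* i) ≡ 2 ℕ.+ 4 ℕ.* i
    index = ℕ-Solver.solve-∀
    step : ∀ i → + 16 * B (2 ℕ.* suc i ℕ.∸ 1) ≡ q (4 ℕ.* suc i) - q (4 ℕ.* i)
    step i = begin
      + 16 * B (2 ℕ.* suc i ℕ.∸ 1)         ≡⟨ cong (λ j → + 16 * B j) (2*suc∸1 i) ⟩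
      + 16 * B (suc (2 ℕ.* i))             ≡⟨ ℤ.*-assoc (+ 8) (+ 2) (B (suc (2 ℕ.* i))) ⟩
      + 8 * (+ 2 * B (suc (2 ℕ.* i)))      ≡⟨ cong (+ 8 *_) (2B≡p[2k] (suc (2 ℕ.* i))) ⟩
      + 8 * p (2 ℕ.* suc (2 ℕ.* i))        ≡⟨ cong (λ j → + 8 * p j) (index i) ⟩
      + 8 * p (2 ℕ.+ 4 ℕ.* i)              ≡⟨ q-4+-sub (4 ℕ.* i) ⟨
      q (4 ℕ.+ 4 ℕ.* i) - q (4 ℕ.* i)      ≡⟨ cong (λ j → q j - q (4 ℕ.* i)) (ℕ.*-suc 4 i) ⟨
      q (4 ℕ.* suc i) - q (4 ℕ.* i)        ∎

  sum-c : ∀ M → + 2 * ∑ 1 M c ≡ q (2 ℕ.* M) - + 1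
  sum-c M = ∑-telescope 1 M (+ 2) c (λ i → q (2 ℕ.* i))
    (λ i → trans (cong (+ 2 *_) (c≡q[1+2k] i)) (sym (q-even-step i)))

  sum-P : ∀ M → + 2 * ∑ 1 M P ≡ q (suc M) - + 1
  sum-P M = ∑-telescope 1 M (+ 2) P (λ i → q (suc i))
    (λ i → trans (cong (+ 2 *_) (P≡p (suc i))) (sym (q-suc-sub (suc i))))

  sum-Q-odd : ∀ M → ∑ 1 M (λ i → Q (2 ℕ.* i ℕ.∸ 1)) ≡ q (2 ℕ.* M) - + 1
  sum-Q-odd M = trans (sym (ℤ.*-identityˡ _)) (∑-telescope 1 M (+ 1) _ (λ i → q (2 ℕ.* i)) step)
    where
    step : ∀ i → + 1 * Q (2 ℕ.* suc i ℕ.∸ 1) ≡ q (2 ℕ.* suc i) - q (2 ℕ.* i)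
    step i = begin
      + 1 * Q (2 ℕ.* suc i ℕ.∸ 1)  ≡⟨ ℤ.*-identityˡ _ ⟩
      Q (2 ℕ.* suc i ℕ.∸ 1)        ≡⟨ cong Q (2*suc∸1 i) ⟩
      Q (suc (2 ℕ.* i))            ≡⟨ Q≡2q (suc (2 ℕ.* i)) ⟩
      + 2 * q (suc (2 ℕ.* i))      ≡⟨ q-even-step i ⟨
      q (2 ℕ.* suc i) - q (2 ℕ.* i) ∎

  sum-Q-odd′ : ∀ M → ∑ 0 M (λ i → Q (2 ℕ.* i ℕ.+ 1)) ≡ q (2 ℕ.* suc M) - + 1
  sum-Q-odd′ M = trans (sym (ℤ.*-identityˡ _)) (∑-telescope 0 M (+ 1) _ (λ i → q (2 ℕ.* i)) step)
    where
    step : ∀ i → + 1 * Q (2 ℕ.* i ℕ.+ 1) ≡ q (2 ℕ.* suc i) - q (2 ℕ.* i)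
    step i = begin
      + 1 * Q (2 ℕ.* i ℕ.+ 1)      ≡⟨ ℤ.*-identityˡ _ ⟩
      Q (2 ℕ.* i ℕ.+ 1)            ≡⟨ cong Q (ℕ.+-comm (2 ℕ.* i) 1) ⟩
      Q (suc (2 ℕ.* i))            ≡⟨ Q≡2q (suc (2 ℕ.* i)) ⟩
      + 2 * q (suc (2 ℕ.* i))      ≡⟨ q-even-step i ⟨
      q (2 ℕ.* suc i) - q (2 ℕ.* i) ∎


module NeoBalcobalancingNumbers where

  open import Data.Nat
  open import Data.Nat.Properties
  open import Data.Nat.Tactic.RingSolver using (solve-∀)
  open import Data.Nat.Induction using (<-rec)
  open import Data.Nat.ListAction using (sum)
  open import Data.Nat.ListAction.Properties using (sum-++)
  open import Data.List using (List; applyUpTo; length; [_]; _++_)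
  open import Data.List.Properties using (applyUpTo-∷ʳ; length-applyUpTo)
  open import Data.List.Membership.Propositional using (_∈_)
  open import Data.List.Membership.Propositional.Properties using (∈-applyUpTo⁺; ∈-applyUpTo⁻)
  open import Data.List.Membership.Propositional.Properties.WithK using (unique∧set⇒bag)
  open import Data.List.Relation.Unary.Unique.Propositional using (Unique)
  open import Data.List.Relation.Unary.Unique.Propositional.Properties using (applyUpTo⁺₁)
  open import Data.List.Relation.Binary.BagAndSetEquality using (∼bag⇒↭)
  open import Data.List.Relation.Binary.Permutation.Propositional.Properties using (↭-length)
  open import Data.Product using (∃; ∃₂; _×_; _,_; proj₁; proj₂)
  open import Data.Sum using (inj₁; inj₂)
  open import Data.Bool using (T)
  open import Function.Base using (case_of_)
  open import Function.Bundles using (_⇔_; mk⇔; Equivalence)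
  open import Function.Properties.Equivalence using () renaming (trans to ⇔-trans; sym to ⇔-sym)
  open import Relation.Nullary using (yes; no)
  open import Data.Empty using (⊥-elim)
  open import Relation.Binary.PropositionalEquality hiding ([_])

  module _ {f : ℕ → ℕ} (f-strictMono : ∀ {i j} → i < j → f i < f j) where

    strictMono⇒injective : ∀ {i j} → f i ≡ f j → i ≡ j
    strictMono⇒injective e = ≤-antisym
      (≮⇒≥ λ j<i → <-irrefl (sym e) (f-strictMono j<i))
      (≮⇒≥ λ i<j → <-irrefl e (f-strictMono i<j))

    strictMono⇒reflects-< : ∀ {i j} → f i < f j → i < j
    strictMono⇒reflects-< {i} {j} lt = ≰⇒> λ j≤i → case m≤n⇒m<n∨m≡n j≤i of λ where
      (inj₁ j<i)  → <-asym lt (f-strictMono j<i)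
      (inj₂ refl) → <-irrefl refl lt

  m*m<n*n⇒m<n : ∀ {m n} → m * m < n * n → m < n
  m*m<n*n⇒m<n = strictMono⇒reflects-< (λ i<j → *-mono-< i<j i<j)

  m*m≡n*n⇒m≡n : ∀ {m n} → m * m ≡ n * n → m ≡ n
  m*m≡n*n⇒m≡n = strictMono⇒injective (λ i<j → *-mono-< i<j i<j)

  m*m+k+δ≡n*n+k⇒m<n : ∀ {m n} k δ → m * m + k + suc δ ≡ n * n + k → m < n
  m*m+k+δ≡n*n+k⇒m<n {m} {n} k δ e =
    m*m<n*n⇒m<n (+-cancelʳ-< k (m * m) (n * n) (subst (m * m + k <_) e (m<m+n (m * m + k) z<s)))

  no-square-between : ∀ k {m n} → T (k * k <ᵇ n) → T (n <ᵇ suc k * suc k) → m * m ≢ n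
  no-square-between k {m} {n} lo hi refl =
    <⇒≱ (m*m<n*n⇒m<n {k} {m} (<ᵇ⇒< (k * k) n lo))
        (≤-pred (m*m<n*n⇒m<n {m} {suc k} (<ᵇ⇒< n (suc k * suc k) hi)))

  +-cancel-⇔ : ∀ {a b x y} → a + x ≡ b + y → (a ≡ b ⇔ x ≡ y)
  +-cancel-⇔ {a} {b} {x} {y} e = mk⇔
    (λ a≡b → +-cancelˡ-≡ b x y (trans (cong (_+ x) (sym a≡b)) e))
    (λ x≡y → +-cancelʳ-≡ y a b (trans (cong (a +_) (sym x≡y)) e))

  gauss : ∀ lo n → 2 * sum (applyUpTo (lo +_) n) + n ≡ n * (2 * lo + n)
  gauss lo zero    = refl
  gauss lo (suc n) = begin
    2 * sum (applyUpTo (lo +_) (suc n)) + suc n         ≡⟨ cong (λ xs → 2 * sum xs + suc n) (applyUpTo-∷ʳ (lo +_) n) ⟨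
    2 * sum (applyUpTo (lo +_) n ++ [ lo + n ]) + suc n ≡⟨ cong (λ s → 2 * s + suc n) (sum-++ (applyUpTo (lo +_) n) [ lo + n ]) ⟩
    2 * (S + (lo + n + 0)) + suc n                      ≡⟨ regroup S lo n ⟩
    (2 * S + n) + (2 * lo + 2 * n + 1)                  ≡⟨ cong (_+ (2 * lo + 2 * n + 1)) (gauss lo n) ⟩
    n * (2 * lo + n) + (2 * lo + 2 * n + 1)             ≡⟨ expand lo n ⟩
    suc n * (2 * lo + suc n)                            ∎
    where
    open ≡-Reasoning
    S = sum (applyUpTo (lo +_) n)
    regroup : ∀ S lo n → 2 * (S + (lo + n + 0)) + suc n ≡ (2 * S + n) + (2 * lo + 2 * n + 1)
    regroup = solve-∀
    expand : ∀ lo n → n * (2 * lo + n) + (2 * lo + 2 * n + 1) ≡ suc n * (2 * lo + suc n)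
    expand = solve-∀

  unique-same-elements⇒length≡ : ∀ {xs ys : List ℕ} → Unique xs → Unique ys →
                                 (∀ {x} → x ∈ xs → x ∈ ys) → (∀ {x} → x ∈ ys → x ∈ xs) →
                                 length xs ≡ length ys
  unique-same-elements⇒length≡ xs! ys! xs⊆ys ys⊆xs =
    ↭-length (∼bag⇒↭ (unique∧set⇒bag xs! ys! (mk⇔ xs⊆ys ys⊆xs)))

  NeoSquare : ℕ → ℕ → Set
  NeoSquare m C = C * C + 12 * m ≡ 8 * m * m + 9

  neoSquare-unique : ∀ m {C C′} → NeoSquare m C → NeoSquare m C′ → C ≡ C′
  neoSquare-unique m {C} {C′} sq sq′ =
    m*m≡n*n⇒m≡n (+-cancelʳ-≡ (12 * m) (C * C) (C′ * C′) (trans sq (sym sq′)))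

  -- (4m − 3) + C√2 ↦ (17 + 12√2)((4m − 3) + C√2), which preserves (4m − 3)² − 2C² = −9.
  record Ascends (m C m′ C′ : ℕ) : Set where
    constructor ascends
    field
      ascends-b : m′ + 12 ≡ 17 * m + 6 * C
      ascends-C : C′ + 36 ≡ 48 * m + 17 * C

  ascends-functional : ∀ {m C m′ C′ m″ C″} → Ascends m C m′ C′ → Ascends m C m″ C″ →
                       m′ ≡ m″ × C′ ≡ C″
  ascends-functional {m′ = m′} {C′} {m″} {C″} (ascends e₁ e₂) (ascends e₁′ e₂′) =
    +-cancelʳ-≡ 12 m′ m″ (trans e₁ (sym e₁′)) , +-cancelʳ-≡ 36 C′ C″ (trans e₂ (sym e₂′))

  ascent-preserves-square : ∀ {m C m′ C′} → Ascends m C m′ C′ → NeoSquare m C ⇔ NeoSquare m′ C′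
  ascent-preserves-square {m} {C} {m′} {C′} (ascends e₁ e₂) =
    ⇔-trans (+-cancel-⇔ (invariance m C))
            (⇔-sym (subst₂ (λ M K → NeoSquare m′ C′ ⇔ Shifted M K) e₁ e₂ (+-cancel-⇔ (shift m′ C′))))
    where
    Shifted : ℕ → ℕ → Set
    Shifted M K = 8 * M * M + 72 * K + 9 ≡ K * K + 204 * M
    shift : ∀ m C → (C * C + 12 * m) + (8 * (m + 12) * (m + 12) + 72 * (C + 36) + 9)
                  ≡ (8 * m * m + 9) + ((C + 36) * (C + 36) + 204 * (m + 12))
    shift = solve-∀
    invariance : ∀ m C → (C * C + 12 * m) + (8 * (17 * m + 6 * C) * (17 * m + 6 * C) + 72 * (48 * m + 17 * C) + 9)
                       ≡ (8 * m * m + 9) + ((48 * m + 17 * C) * (48 * m + 17 * C) + 204 * (17 * m + 6 * C))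
    invariance = solve-∀

  -- b = 6 + δb and R = 1 + δr, so that b′ = 29b + 12R − 6, R′ = 12b + 5R − 4 needs no subtraction.
  mutual
    δb : ℕ → ℕ
    δb zero    = 0
    δb (suc k) = 174 + 29 * δb k + 12 * δr k

    δr : ℕ → ℕ
    δr zero    = 0
    δr (suc k) = 72 + 12 * δb k + 5 * δr k

  neoB neoR neoC : ℕ → ℕ
  neoB k = 6 + δb k
  neoR k = 1 + δr k
  neoC k = 2 * neoR k + 2 * neoB k + 1

  neo-ascent : ∀ k → Ascends (neoB k) (neoC k) (neoB (suc k)) (neoC (suc k))
  neo-ascent k = ascends (ascent-b (δb k) (δr k)) (ascent-C (δb k) (δr k))
    where
    ascent-b : ∀ a s → 6 + (174 + 29 * a + 12 * s) + 12 ≡ 17 * (6 + a) + 6 * (2 * (1 + s) + 2 * (6 + a) + 1)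
    ascent-b = solve-∀
    ascent-C : ∀ a s → 2 * (1 + (72 + 12 * a + 5 * s)) + 2 * (6 + (174 + 29 * a + 12 * s)) + 1 + 36
                     ≡ 48 * (6 + a) + 17 * (2 * (1 + s) + 2 * (6 + a) + 1)
    ascent-C = solve-∀

  neo-square : ∀ k → NeoSquare (neoB k) (neoC k)
  neo-square zero    = refl
  neo-square (suc k) = Equivalence.to (ascent-preserves-square (neo-ascent k)) (neo-square k)

  neoB-<-suc : ∀ k → neoB k < neoB (suc k)
  neoB-<-suc k = subst (neoB k <_) (sym (split (δb k) (δr k))) (m≤m+n (suc (neoB k)) (173 + 28 * δb k + 12 * δr k))
    where
    split : ∀ a s → 6 + (174 + 29 * a + 12 * s) ≡ suc (6 + a) + (173 + 28 * a + 12 * s)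
    split = solve-∀

  neoB-strictMono : ∀ {i j} → i < j → neoB i < neoB j
  neoB-strictMono {i} {suc j} (s≤s i≤j) = case m≤n⇒m<n∨m≡n i≤j of λ where
    (inj₁ i<j)  → <-trans (neoB-strictMono i<j) (neoB-<-suc j)
    (inj₂ refl) → neoB-<-suc j

  neoSquare-below-7 : ∀ m C → 0 < m → m ≤ 6 → NeoSquare m C → m ≡ 6 × C ≡ 15
  neoSquare-below-7 1 C _ _ sq = ⊥-elim (no-square-between 2 {C} _ _ (+-cancelʳ-≡ 12 (C * C) 5 sq))
  neoSquare-below-7 2 C _ _ sq = ⊥-elim (no-square-between 4 {C} _ _ (+-cancelʳ-≡ 24 (C * C) 17 sq))
  neoSquare-below-7 3 C _ _ sq = ⊥-elim (no-square-between 6 {C} _ _ (+-cancelʳ-≡ 36 (C * C) 45 sq))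
  neoSquare-below-7 4 C _ _ sq = ⊥-elim (no-square-between 9 {C} _ _ (+-cancelʳ-≡ 48 (C * C) 89 sq))
  neoSquare-below-7 5 C _ _ sq = ⊥-elim (no-square-between 12 {C} _ _ (+-cancelʳ-≡ 60 (C * C) 149 sq))
  neoSquare-below-7 6 C _ _ sq = refl , m*m≡n*n⇒m≡n (+-cancelʳ-≡ 72 (C * C) (15 * 15) sq)
  neoSquare-below-7 (suc (suc (suc (suc (suc (suc (suc _))))))) _ _ (s≤s (s≤s (s≤s (s≤s (s≤s (s≤s ())))))) _

  neoSquare-bounds : ∀ d C → NeoSquare (7 + d) C →
                     6 * C < 107 + 17 * d × 100 + 16 * d < 6 * C × 300 + 48 * d < 17 * C
  neoSquare-bounds d C sq =
    m*m+k+δ≡n*n+k⇒m<n (6 * 6 * 12 * (7 + d)) (36 + 38 * d + d * d)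
      (trans (cong (_+ suc (36 + 38 * d + d * d)) (scaled 6)) (upper-6C d)) ,
    m*m+k+δ≡n*n+k⇒m<n (6 * 6 * 12 * (7 + d)) (1411 + 400 * d + 32 * d * d) (trans (lower-6C d) (sym (scaled 6))) ,
    m*m+k+δ≡n*n+k⇒m<n (17 * 17 * 12 * (7 + d)) (1612 + 100 * d + 8 * d * d) (trans (lower-17C d) (sym (scaled 17)))
    where
    scaled : ∀ c → c * C * (c * C) + c * c * 12 * (7 + d) ≡ c * c * (8 * (7 + d) * (7 + d) + 9)
    scaled c = trans (factor c C (7 + d)) (cong (c * c *_) sq)
      where
      factor : ∀ c C m → c * C * (c * C) + c * c * 12 * m ≡ c * c * (C * C + 12 * m)
      factor = solve-∀
    upper-6C : ∀ d → 6 * 6 * (8 * (7 + d) * (7 + d) + 9) + suc (36 + 38 * d + d * d)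
                   ≡ (107 + 17 * d) * (107 + 17 * d) + 6 * 6 * 12 * (7 + d)
    upper-6C = solve-∀
    lower-6C : ∀ d → (100 + 16 * d) * (100 + 16 * d) + 6 * 6 * 12 * (7 + d) + suc (1411 + 400 * d + 32 * d * d)
                   ≡ 6 * 6 * (8 * (7 + d) * (7 + d) + 9)
    lower-6C = solve-∀
    lower-17C : ∀ d → (300 + 48 * d) * (300 + 48 * d) + 17 * 17 * 12 * (7 + d) + suc (1612 + 100 * d + 8 * d * d)
                    ≡ 17 * 17 * (8 * (7 + d) * (7 + d) + 9)
    lower-17C = solve-∀

  descent-below : ∀ {d C e} → 100 + 16 * d < 6 * C → suc (6 * C) + e ≡ 107 + 17 * d → suc e < 7 + d
  descent-below {d} {C} {e} 100+16d<6C e-def = s≤s (+-cancelˡ-≤ (101 + 16 * d) (suc e) (6 + d) (begin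
    101 + 16 * d + suc e   ≤⟨ +-monoˡ-≤ (suc e) 100+16d<6C ⟩
    6 * C + suc e          ≡⟨ +-suc (6 * C) e ⟩
    suc (6 * C) + e        ≡⟨ e-def ⟩
    107 + 17 * d           ≡⟨ split d ⟩
    101 + 16 * d + (6 + d) ∎))
    where
    open ≤-Reasoning
    split : ∀ d → 107 + 17 * d ≡ 101 + 16 * d + (6 + d)
    split = solve-∀

  descent-ascends : ∀ {d C e f} → suc (6 * C) + e ≡ 107 + 17 * d → 300 + 48 * d + f ≡ 17 * C →
                    Ascends (suc e) f (7 + d) C
  descent-ascends {d} {C} {e} {f} e-def f-def = ascends
    (+-cancelʳ-≡ (102 * C + 1800 + 288 * d) _ _
      (trans (lhs-b C d) (sym (trans (rhs-b C d e f) (cong₂ (λ u v → 17 * u + 6 * v) e-def f-def)))))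
    (+-cancelʳ-≡ (288 * C + 5100 + 816 * d) _ _
      (trans (lhs-C C d) (sym (trans (rhs-C C d e f) (cong₂ (λ u v → 48 * u + 17 * v) e-def f-def)))))
    where
    lhs-b : ∀ C d → 7 + d + 12 + (102 * C + 1800 + 288 * d) ≡ 17 * (107 + 17 * d) + 6 * (17 * C)
    lhs-b = solve-∀
    rhs-b : ∀ C d e f → 17 * suc e + 6 * f + (102 * C + 1800 + 288 * d)
                      ≡ 17 * (suc (6 * C) + e) + 6 * (300 + 48 * d + f)
    rhs-b = solve-∀
    lhs-C : ∀ C d → C + 36 + (288 * C + 5100 + 816 * d) ≡ 48 * (107 + 17 * d) + 17 * (17 * C)
    lhs-C = solve-∀
    rhs-C : ∀ C d e f → 48 * suc e + 17 * f + (288 * C + 5100 + 816 * d)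
                      ≡ 48 * (suc (6 * C) + e) + 17 * (300 + 48 * d + f)
    rhs-C = solve-∀

  -- The inverse ascent (m, C) ↦ (17m − 6C − 12, 17C − 48m + 36); the bounds keep it inside 1 ≤ m′ < m.
  neoSquare-descent : ∀ d C → NeoSquare (7 + d) C →
                      ∃₂ λ m′ C′ → 0 < m′ × m′ < 7 + d × Ascends m′ C′ (7 + d) C
  neoSquare-descent d C sq =
    descend (m≤n⇒∃[o]m+o≡n 6C<107+17d) (m≤n⇒∃[o]m+o≡n (<⇒≤ 300+48d<17C))
    where
    6C<107+17d  = proj₁ (neoSquare-bounds d C sq)
    100+16d<6C  = proj₁ (proj₂ (neoSquare-bounds d C sq))
    300+48d<17C = proj₂ (proj₂ (neoSquare-bounds d C sq))
    descend : (∃ λ e → suc (6 * C) + e ≡ 107 + 17 * d) → (∃ λ f → 300 + 48 * d + f ≡ 17 * C) →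
              ∃₂ λ m′ C′ → 0 < m′ × m′ < 7 + d × Ascends m′ C′ (7 + d) C
    descend (e , e-def) (f , f-def) =
      suc e , f , z<s , descent-below {d} {C} {e} 100+16d<6C e-def , descent-ascends {d} {C} {e} {f} e-def f-def

  InNeoSequence : ℕ → ℕ → Set
  InNeoSequence m C = ∃ λ k → m ≡ neoB k × C ≡ neoC k

  neoSquare-step : ∀ d C →
                   (∀ {m′} → m′ < 7 + d → ∀ C′ → 0 < m′ → NeoSquare m′ C′ → InNeoSequence m′ C′) →
                   NeoSquare (7 + d) C → InNeoSequence (7 + d) C
  neoSquare-step d C rec sq = below (neoSquare-descent d C sq)
    where
    below : (∃₂ λ m′ C′ → 0 < m′ × m′ < 7 + d × Ascends m′ C′ (7 + d) C) → InNeoSequence (7 + d) C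
    below (m′ , C′ , 0<m′ , m′<7+d , ascent) =
      next (rec m′<7+d C′ 0<m′ (Equivalence.from (ascent-preserves-square ascent) sq))
      where
      next : InNeoSequence m′ C′ → InNeoSequence (7 + d) C
      next (k , m′≡ , C′≡) =
        suc k , ascends-functional (subst₂ (λ a b → Ascends a b (7 + d) C) m′≡ C′≡ ascent) (neo-ascent k)

  neoSquare⇒inNeoSequence : ∀ m C → 0 < m → NeoSquare m C → InNeoSequence m C
  neoSquare⇒inNeoSequence = <-rec _ classify
    where
    classify : ∀ m → (∀ {m′} → m′ < m → ∀ C → 0 < m′ → NeoSquare m′ C → InNeoSequence m′ C) →
               ∀ C → 0 < m → NeoSquare m C → InNeoSequence m C
    classify m rec C 0<m sq with m ≤? 6
    ... | yes m≤6 = 0 , neoSquare-below-7 m C 0<m m≤6 sq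
    ... | no m≰6 = above (m≤n⇒∃[o]m+o≡n (≰⇒> m≰6))
      where
      above : (∃ λ d → 7 + d ≡ m) → InNeoSequence m C
      above (d , 7+d≡m) = subst (λ m → InNeoSequence m C) 7+d≡m
        (neoSquare-step d C (λ m′<7+d → rec (subst (_ <_) 7+d≡m m′<7+d))
                            (subst (λ m → NeoSquare m C) (sym 7+d≡m) sq))

  balancer⇔neoSquare : ∀ m₀ r → (∑ℕid 1 m₀ + ∑ℕid 1 (suc m₀) ≡ 2 * ∑ℕid m₀ (suc m₀ + r))
                              ⇔ NeoSquare (suc m₀) (2 * r + 2 * suc m₀ + 1)
  balancer⇔neoSquare m₀ r = ⇔-trans scale (+-cancel-⇔ (trans (identity S₁ S₂ S₃ m₀ r) (cong shape gauss-terms)))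
    where
    S₁ = ∑ℕid 1 m₀
    S₂ = ∑ℕid 1 (suc m₀)
    S₃ = ∑ℕid m₀ (suc m₀ + r)
    length-S₃ : suc (suc m₀ + r) ∸ m₀ ≡ 2 + r
    length-S₃ = trans (cong (_∸ m₀) (shift m₀ r)) (m+n∸m≡n m₀ (2 + r))
      where
      shift : ∀ m₀ r → suc (suc m₀ + r) ≡ m₀ + (2 + r)
      shift = solve-∀
    gauss-S₃ : 2 * S₃ + (2 + r) ≡ (2 + r) * (2 * m₀ + (2 + r))
    gauss-S₃ = subst (λ n → 2 * sum (applyUpTo (m₀ +_) n) + (2 + r) ≡ (2 + r) * (2 * m₀ + (2 + r)))
                     (sym length-S₃) (gauss m₀ (2 + r))
    K : ℕ
    K = 2 * (m₀ * (2 * 1 + m₀)) + 2 * (suc m₀ * (2 * 1 + suc m₀)) + 4 * (2 * S₃ + (2 + r))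
    gauss-terms : 2 * (2 * S₁ + m₀) + 2 * (2 * S₂ + suc m₀) + 4 * ((2 + r) * (2 * m₀ + (2 + r))) ≡ K
    gauss-terms = cong₂ (λ x y → x + 4 * y) (cong₂ (λ x y → 2 * x + 2 * y) (gauss 1 m₀) (gauss 1 (suc m₀)))
                        (sym gauss-S₃)
    -- Both sides of each Gauss equation occur, so that this is a semiring identity in free S₁, S₂, S₃.
    identity : ∀ S₁ S₂ S₃ m₀ r →
      4 * (S₁ + S₂) + (2 * (m₀ * (2 * 1 + m₀)) + 2 * (suc m₀ * (2 * 1 + suc m₀)) + 4 * (2 * S₃ + (2 + r)))
        + ((2 * r + 2 * suc m₀ + 1) * (2 * r + 2 * suc m₀ + 1) + 12 * suc m₀)
      ≡ 4 * (2 * S₃) + (2 * (2 * S₁ + m₀) + 2 * (2 * S₂ + suc m₀) + 4 * ((2 + r) * (2 * m₀ + (2 + r))))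
        + (8 * suc m₀ * suc m₀ + 9)
    identity = solve-∀
    shape : ℕ → ℕ
    shape t = 4 * (2 * S₃) + t + (8 * suc m₀ * suc m₀ + 9)
    scale : (S₁ + S₂ ≡ 2 * S₃) ⇔ (4 * (S₁ + S₂) + K ≡ 4 * (2 * S₃) + K)
    scale = mk⇔ (cong (λ t → 4 * t + K)) (λ e → *-cancelˡ-≡ _ _ 4 (+-cancelʳ-≡ K _ _ e))

  balancer⇒neoSquare : ∀ m r → IsNeoBalcobalancer m r → NeoSquare m (2 * r + 2 * m + 1)
  balancer⇒neoSquare (suc m₀) r (_ , _ , balanced) = Equivalence.to (balancer⇔neoSquare m₀ r) balanced

  neoB-balancer : ∀ k → IsNeoBalcobalancer (neoB k) (neoR k)
  neoB-balancer k = s≤s z≤n , s≤s z≤n , Equivalence.from (balancer⇔neoSquare (5 + δb k) (neoR k)) (neo-square k)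

  isNeoBC⇒neoB : ∀ m → IsNeoBC m → ∃ λ k → m ≡ neoB k
  isNeoBC⇒neoB m (r , balancer@(0<m , _))
    with k , m≡ , _ ← neoSquare⇒inNeoSequence m (2 * r + 2 * m + 1) 0<m (balancer⇒neoSquare m r balancer) = k , m≡

  nth-neoBC : ∀ n m → IsNthNeoBC n m → m ≡ neoB (n ∸ 1)
  nth-neoBC n m (neoBC , xs , xs! , length-xs , members) = trans m≡ (cong neoB (trans (sym count) length-xs))
    where
    k = proj₁ (isNeoBC⇒neoB m neoBC)
    m≡ = proj₂ (isNeoBC⇒neoB m neoBC)
    xs⊆ : ∀ {x} → x ∈ xs → x ∈ applyUpTo neoB k
    xs⊆ {x} x∈xs with x<m , x-neoBC ← proj₁ (members x) x∈xs with j , refl ← isNeoBC⇒neoB x x-neoBC =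
      ∈-applyUpTo⁺ neoB (strictMono⇒reflects-< neoB-strictMono {j} {k} (subst (neoB j <_) m≡ x<m))
    ⊆xs : ∀ {x} → x ∈ applyUpTo neoB k → x ∈ xs
    ⊆xs x∈ with j , j<k , refl ← ∈-applyUpTo⁻ neoB x∈ =
      proj₂ (members (neoB j)) (subst (neoB j <_) (sym m≡) (neoB-strictMono j<k)) (neoR j , neoB-balancer j)
    count : length xs ≡ k
    count = trans (unique-same-elements⇒length≡ xs! ys! xs⊆ ⊆xs) (length-applyUpTo neoB k)
      where
      ys! = applyUpTo⁺₁ neoB k (λ i<j _ → <⇒≢ (neoB-strictMono i<j))


open import Data.Nat using (ℕ; _≤_; zero; suc)
import Data.Nat as ℕ
import Data.Nat.Properties as ℕ
import Data.Nat.Tactic.RingSolver as ℕ-Solver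
open import Data.Integer using (ℤ; +_; _+_; _-_; _*_; -_)
import Data.Integer.Properties as ℤ
open import Data.Integer.Tactic.RingSolver using (solve-∀)
open import Data.Product using (_×_; _,_)
open import Relation.Binary.PropositionalEquality using (_≡_; refl; sym; trans; cong; cong₂; subst; module ≡-Reasoning)
open ≡-Reasoning
open Pell
open NeoBalcobalancingNumbers
  using (NeoSquare; neoSquare-unique; Ascends; ascends; neoB; neoC; neo-ascent; neo-square; balancer⇒neoSquare; nth-neoBC)

-- 4b − 3 + C√2 = 3(1 + √2)^(g+3)
record PellPoint (g : ℕ) (b C : ℤ) : Set where
  constructor pellPoint
  field
    4b≡ : + 4 * b ≡ + 3 * q (3 ℕ.+ g) + + 3
    C≡  : C ≡ + 3 * p (3 ℕ.+ g)

pellPoint-linear : ∀ {g b C} → PellPoint g b C → ∀ (α β γ : ℤ) →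
                   α * (+ 4 * b) + β * C + γ
                   ≡ α * (+ 3 * (+ 7 * q g + + 10 * p g) + + 3) + β * (+ 3 * (+ 5 * q g + + 7 * p g)) + γ
pellPoint-linear {g} (pellPoint 4b≡ C≡) α β γ =
  cong₂ (λ x y → α * x + β * y + γ) (trans 4b≡ (cong (λ x → + 3 * x + + 3) q₃)) (trans C≡ (cong (+ 3 *_) (p-+ 3 g)))
  where
  q₃ : q (3 ℕ.+ g) ≡ + 7 * q g + + 10 * p g
  q₃ = trans (q-+ 3 g) (expand (q g) (p g))
    where
    expand : ∀ a b → + 7 * a + + 2 * (+ 5 * b) ≡ + 7 * a + + 10 * b
    expand = solve-∀

pellPoint-2C-4b : ∀ {g b C} → PellPoint g b C → - (+ 4 * b) + + 2 * C + + 3 ≡ + 3 * q (2 ℕ.+ g)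
pellPoint-2C-4b {g} {b} {C} pt =
  trans (linear b C) (trans (pellPoint-linear pt (- + 1) (+ 2) (+ 3)) (reduce (q g) (p g)))
  where
  linear : ∀ b C → - (+ 4 * b) + + 2 * C + + 3 ≡ - + 1 * (+ 4 * b) + + 2 * C + + 3
  linear = solve-∀
  reduce : ∀ a b → - + 1 * (+ 3 * (+ 7 * a + + 10 * b) + + 3) + + 2 * (+ 3 * (+ 5 * a + + 7 * b)) + + 3
                   ≡ + 3 * ((a + + 2 * b) + + 2 * (a + b))
  reduce = solve-∀

sum-B-identity : ∀ n {b C} → PellPoint (4 ℕ.* n) b C →
                 + 36 * ∑ 1 (2 ℕ.* n) (λ i → B (2 ℕ.* i ℕ.∸ 1))
                 ≡ (+ 20 * b - + 7 * C - + 15) * (+ 20 * b - + 7 * C - + 15)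
sum-B-identity n {b} {C} pt = ℤ.*-cancelˡ-≡ (+ 4) _ _ (begin
  + 4 * (+ 36 * S)                    ≡⟨ regroup S ⟩
  + 9 * (+ 16 * S)                    ≡⟨ cong (+ 9 *_) (sum-B (2 ℕ.* n)) ⟩
  + 9 * (q (4 ℕ.* (2 ℕ.* n)) - + 1)   ≡⟨ cong₂ (λ j N → + 9 * (q j - N)) (index n) (sym (pell-norm-4* n)) ⟩
  + 9 * (q (g ℕ.+ g) - pell-norm g)   ≡⟨ cong (+ 9 *_) (q-double-sub-norm g) ⟩
  + 9 * (+ 4 * (p g * p g))           ≡⟨ square (p g) ⟩
  + 4 * ((+ 3 * p g) * (+ 3 * p g))   ≡⟨ cong (λ x → + 4 * (x * x)) lin ⟨
  + 4 * ((+ 20 * b - + 7 * C - + 15) * (+ 20 * b - + 7 * C - + 15)) ∎)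
  where
  g = 4 ℕ.* n
  S = ∑ 1 (2 ℕ.* n) (λ i → B (2 ℕ.* i ℕ.∸ 1))
  index : ∀ n → 4 ℕ.* (2 ℕ.* n) ≡ 4 ℕ.* n ℕ.+ 4 ℕ.* n
  index = ℕ-Solver.solve-∀
  regroup : ∀ S → + 4 * (+ 36 * S) ≡ + 9 * (+ 16 * S)
  regroup = solve-∀
  square : ∀ x → + 9 * (+ 4 * (x * x)) ≡ + 4 * ((+ 3 * x) * (+ 3 * x))
  square = solve-∀
  lin : + 20 * b - + 7 * C - + 15 ≡ + 3 * p g
  lin = trans (linear b C) (trans (pellPoint-linear pt (+ 5) (- + 7) (- + 15)) (reduce (q g) (p g)))
    where
    linear : ∀ b C → + 20 * b - + 7 * C - + 15 ≡ + 5 * (+ 4 * b) + - + 7 * C + - + 15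
    linear = solve-∀
    reduce : ∀ a b → + 5 * (+ 3 * (+ 7 * a + + 10 * b) + + 3) + - + 7 * (+ 3 * (+ 5 * a + + 7 * b)) + - + 15 ≡ + 3 * b
    reduce = solve-∀

half-sum-identity : ∀ g {S} → pell-norm g ≡ + 1 → + 2 * S ≡ q (g ℕ.+ g) - + 1 →
                    + 9 * (+ 1 + S) ≡ (+ 3 * q g) * (+ 3 * q g)
half-sum-identity g {S} norm 2S≡ = ℤ.*-cancelˡ-≡ (+ 2) _ _ (begin
  + 2 * (+ 9 * (+ 1 + S))             ≡⟨ regroup S ⟩
  + 9 * (+ 2 * S + + 2)               ≡⟨ cong (λ x → + 9 * (x + + 2)) 2S≡ ⟩
  + 9 * (q (g ℕ.+ g) - + 1 + + 2)     ≡⟨ cong (+ 9 *_) (shift (q (g ℕ.+ g))) ⟩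
  + 9 * (q (g ℕ.+ g) + + 1)           ≡⟨ cong (λ N → + 9 * (q (g ℕ.+ g) + N)) norm ⟨
  + 9 * (q (g ℕ.+ g) + pell-norm g)   ≡⟨ cong (+ 9 *_) (q-double-add-norm g) ⟩
  + 9 * (+ 2 * (q g * q g))           ≡⟨ square (q g) ⟩
  + 2 * ((+ 3 * q g) * (+ 3 * q g))   ∎)
  where
  regroup : ∀ S → + 2 * (+ 9 * (+ 1 + S)) ≡ + 9 * (+ 2 * S + + 2)
  regroup = solve-∀
  shift : ∀ x → x - + 1 + + 2 ≡ x + + 1
  shift = solve-∀
  square : ∀ x → + 9 * (+ 2 * (x * x)) ≡ + 2 * ((+ 3 * x) * (+ 3 * x))
  square = solve-∀

sum-c-identity : ∀ n {b r C} → PellPoint (4 ℕ.* n) b C → C ≡ + 2 * r + + 2 * b + + 1 →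
                 + 9 * (+ 1 + ∑ 1 (4 ℕ.* n ℕ.+ 2) c) ≡ (+ 4 * r + + 5) * (+ 4 * r + + 5)
sum-c-identity n {b} {r} {C} pt C≡ = begin
  + 9 * (+ 1 + ∑ 1 (4 ℕ.* n ℕ.+ 2) c)  ≡⟨ half-sum-identity g norm 2S≡ ⟩
  (+ 3 * q g) * (+ 3 * q g)            ≡⟨ cong (λ x → x * x) lin ⟨
  (+ 4 * r + + 5) * (+ 4 * r + + 5)    ∎
  where
  g = 2 ℕ.+ 4 ℕ.* n
  2S≡ : + 2 * ∑ 1 (4 ℕ.* n ℕ.+ 2) c ≡ q (g ℕ.+ g) - + 1
  2S≡ = trans (sum-c (4 ℕ.* n ℕ.+ 2)) (cong (λ j → q j - + 1) (index n))
    where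
    index : ∀ n → 2 ℕ.* (4 ℕ.* n ℕ.+ 2) ≡ (2 ℕ.+ 4 ℕ.* n) ℕ.+ (2 ℕ.+ 4 ℕ.* n)
    index = ℕ-Solver.solve-∀
  norm : pell-norm g ≡ + 1
  norm = trans (pell-norm-2+ (4 ℕ.* n)) (pell-norm-4* n)
  lin : + 4 * r + + 5 ≡ + 3 * q g
  lin = trans (trans (eliminate-r b r) (cong (λ x → - (+ 4 * b) + + 2 * x + + 3) (sym C≡))) (pellPoint-2C-4b pt)
    where
    eliminate-r : ∀ b r → + 4 * r + + 5 ≡ - (+ 4 * b) + + 2 * (+ 2 * r + + 2 * b + + 1) + + 3
    eliminate-r = solve-∀

sum-P-identity : ∀ k {b C} → PellPoint (4 ℕ.* k) b C →
                 + 9 * (+ 1 + ∑ 1 (8 ℕ.* suc k ℕ.∸ 5) P)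
                 ≡ (- (+ 4 * b) + + 2 * C + + 3) * (- (+ 4 * b) + + 2 * C + + 3)
sum-P-identity k {b} {C} pt = begin
  + 9 * (+ 1 + ∑ 1 (8 ℕ.* suc k ℕ.∸ 5) P)  ≡⟨ half-sum-identity g norm 2S≡ ⟩
  (+ 3 * q g) * (+ 3 * q g)                ≡⟨ cong (λ x → x * x) (pellPoint-2C-4b pt) ⟨
  (- (+ 4 * b) + + 2 * C + + 3) * (- (+ 4 * b) + + 2 * C + + 3) ∎
  where
  g = 2 ℕ.+ 4 ℕ.* k
  norm : pell-norm g ≡ + 1
  norm = trans (pell-norm-2+ (4 ℕ.* k)) (pell-norm-4* k)
  2S≡ : + 2 * ∑ 1 (8 ℕ.* suc k ℕ.∸ 5) P ≡ q (g ℕ.+ g) - + 1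
  2S≡ = trans (sum-P (8 ℕ.* suc k ℕ.∸ 5)) (cong (λ j → q j - + 1) index)
    where
    double : ∀ k → 4 ℕ.+ 8 ℕ.* k ≡ (2 ℕ.+ 4 ℕ.* k) ℕ.+ (2 ℕ.+ 4 ℕ.* k)
    double = ℕ-Solver.solve-∀
    index : suc (8 ℕ.* suc k ℕ.∸ 5) ≡ g ℕ.+ g
    index = trans (cong (λ j → suc (j ℕ.∸ 5)) (ℕ.*-suc 8 k)) (double k)

sum-Q-identity : ∀ n {b C} → PellPoint (4 ℕ.* n) b C →
                 + 9 * ∑ 1 (4 ℕ.* n) (λ i → Q (2 ℕ.* i ℕ.∸ 1))
                 ≡ (+ 40 * b - + 14 * C - + 30) * (+ 40 * b - + 14 * C - + 30)
sum-Q-identity n {b} {C} pt = begin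
  + 9 * ∑ 1 (4 ℕ.* n) (λ i → Q (2 ℕ.* i ℕ.∸ 1)) ≡⟨ cong (+ 9 *_) (sum-Q-odd (4 ℕ.* n)) ⟩
  + 9 * (q (2 ℕ.* g) - + 1)                   ≡⟨ cong₂ (λ j N → + 9 * (q j - N)) (index g) (sym (pell-norm-4* n)) ⟩
  + 9 * (q (g ℕ.+ g) - pell-norm g)           ≡⟨ cong (+ 9 *_) (q-double-sub-norm g) ⟩
  + 9 * (+ 4 * (p g * p g))                   ≡⟨ square (p g) ⟩
  (+ 6 * p g) * (+ 6 * p g)                   ≡⟨ cong (λ x → x * x) lin ⟨
  (+ 40 * b - + 14 * C - + 30) * (+ 40 * b - + 14 * C - + 30) ∎
  where
  g = 4 ℕ.* n
  index : ∀ g → 2 ℕ.* g ≡ g ℕ.+ g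
  index = ℕ-Solver.solve-∀
  square : ∀ x → + 9 * (+ 4 * (x * x)) ≡ (+ 6 * x) * (+ 6 * x)
  square = solve-∀
  lin : + 40 * b - + 14 * C - + 30 ≡ + 6 * p g
  lin = trans (linear b C) (trans (pellPoint-linear pt (+ 10) (- + 14) (- + 30)) (reduce (q g) (p g)))
    where
    linear : ∀ b C → + 40 * b - + 14 * C - + 30 ≡ + 10 * (+ 4 * b) + - + 14 * C + - + 30
    linear = solve-∀
    reduce : ∀ a b → + 10 * (+ 3 * (+ 7 * a + + 10 * b) + + 3) + - + 14 * (+ 3 * (+ 5 * a + + 7 * b)) + - + 30 ≡ + 6 * b
    reduce = solve-∀

sum-Q′-identity : ∀ n {b C} → PellPoint (4 ℕ.* n) b C →
                  + 9 * ∑ 0 (4 ℕ.* n) (λ i → Q (2 ℕ.* i ℕ.+ 1))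
                  ≡ + 2 * ((+ 12 * b - + 4 * C - + 9) * (+ 12 * b - + 4 * C - + 9))
sum-Q′-identity n {b} {C} pt = begin
  + 9 * ∑ 0 (4 ℕ.* n) (λ i → Q (2 ℕ.* i ℕ.+ 1)) ≡⟨ cong (+ 9 *_) (sum-Q-odd′ (4 ℕ.* n)) ⟩
  + 9 * (q (2 ℕ.* g) + - + 1)                   ≡⟨ cong₂ (λ j N → + 9 * (q j + N)) (index g) (sym norm) ⟩
  + 9 * (q (g ℕ.+ g) + pell-norm g)             ≡⟨ cong (+ 9 *_) (q-double-add-norm g) ⟩
  + 9 * (+ 2 * (q g * q g))                     ≡⟨ square (q g) ⟩
  + 2 * ((+ 3 * q g) * (+ 3 * q g))             ≡⟨ cong (λ x → + 2 * (x * x)) lin ⟨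
  + 2 * ((+ 12 * b - + 4 * C - + 9) * (+ 12 * b - + 4 * C - + 9)) ∎
  where
  g = suc (4 ℕ.* n)
  index : ∀ g → 2 ℕ.* g ≡ g ℕ.+ g
  index = ℕ-Solver.solve-∀
  norm : pell-norm g ≡ - + 1
  norm = trans (pell-norm-suc (4 ℕ.* n)) (cong -_ (pell-norm-4* n))
  square : ∀ x → + 9 * (+ 2 * (x * x)) ≡ + 2 * ((+ 3 * x) * (+ 3 * x))
  square = solve-∀
  lin : + 12 * b - + 4 * C - + 9 ≡ + 3 * q g
  lin = trans (linear b C) (trans (pellPoint-linear pt (+ 3) (- + 4) (- + 9)) (reduce (q (4 ℕ.* n)) (p (4 ℕ.* n))))
    where
    linear : ∀ b C → + 12 * b - + 4 * C - + 9 ≡ + 3 * (+ 4 * b) + - + 4 * C + - + 9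
    linear = solve-∀
    reduce : ∀ a b → + 3 * (+ 3 * (+ 7 * a + + 10 * b) + + 3) + - + 4 * (+ 3 * (+ 5 * a + + 7 * b)) + - + 9 ≡ + 3 * (a + + 2 * b)
    reduce = solve-∀

pos-shift : ∀ {x a b u c v} → x ℕ.+ a ≡ b ℕ.* u ℕ.+ c ℕ.* v → + x ≡ + b * + u + + c * + v - + a
pos-shift {x} {a} {b} {u} {c} {v} e = begin
  + x                                ≡⟨ cancel (+ x) (+ a) ⟩
  + x + + a - + a                    ≡⟨ cong (_- + a) (ℤ.pos-+ x a) ⟨
  + (x ℕ.+ a) - + a                  ≡⟨ cong (λ y → + y - + a) e ⟩
  + (b ℕ.* u ℕ.+ c ℕ.* v) - + a      ≡⟨ cong (_- + a) (ℤ.pos-+ (b ℕ.* u) (c ℕ.* v)) ⟩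
  + (b ℕ.* u) + + (c ℕ.* v) - + a    ≡⟨ cong₂ (λ x y → x + y - + a) (ℤ.pos-* b u) (ℤ.pos-* c v) ⟩
  + b * + u + + c * + v - + a        ∎
  where
  cancel : ∀ x a → x ≡ x + a - a
  cancel = solve-∀

ascent-pellPoint : ∀ {g m C m′ C′} → Ascends m C m′ C′ →
                   PellPoint g (+ m) (+ C) → PellPoint (4 ℕ.+ g) (+ m′) (+ C′)
ascent-pellPoint {g} {m} {C} {m′} {C′} (ascends e₁ e₂) (pellPoint 4b≡ C≡) = pellPoint
  (begin
    + 4 * + m′                                              ≡⟨ cong (+ 4 *_) (pos-shift {m′} {12} {17} {m} {6} {C} e₁) ⟩
    + 4 * (+ 17 * + m + + 6 * + C - + 12)                   ≡⟨ regroup-b (+ m) (+ C) ⟩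
    + 17 * (+ 4 * + m) + + 24 * + C - + 48                  ≡⟨ cong₂ (λ x y → + 17 * x + + 24 * y - + 48) 4b≡ C≡ ⟩
    + 17 * (+ 3 * x + + 3) + + 24 * (+ 3 * y) - + 48        ≡⟨ reduce-b x y ⟩
    + 3 * (q 4 * x + + 2 * (p 4 * y)) + + 3                 ≡⟨ cong (λ x → + 3 * x + + 3) (q-+ 4 (3 ℕ.+ g)) ⟨
    + 3 * q (4 ℕ.+ (3 ℕ.+ g)) + + 3                         ∎)
  (begin
    + C′                                                    ≡⟨ pos-shift {C′} {36} {48} {m} {17} {C} e₂ ⟩
    + 48 * + m + + 17 * + C - + 36                          ≡⟨ regroup-C (+ m) (+ C) ⟩
    + 12 * (+ 4 * + m) + + 17 * + C - + 36                  ≡⟨ cong₂ (λ x y → + 12 * x + + 17 * y - + 36) 4b≡ C≡ ⟩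
    + 12 * (+ 3 * x + + 3) + + 17 * (+ 3 * y) - + 36        ≡⟨ reduce-C x y ⟩
    + 3 * (p 4 * x + q 4 * y)                               ≡⟨ cong (+ 3 *_) (p-+ 4 (3 ℕ.+ g)) ⟨
    + 3 * p (4 ℕ.+ (3 ℕ.+ g))                               ∎)
  where
  x = q (3 ℕ.+ g)
  y = p (3 ℕ.+ g)
  regroup-b : ∀ m C → + 4 * (+ 17 * m + + 6 * C - + 12) ≡ + 17 * (+ 4 * m) + + 24 * C - + 48
  regroup-b = solve-∀
  reduce-b : ∀ x y → + 17 * (+ 3 * x + + 3) + + 24 * (+ 3 * y) - + 48 ≡ + 3 * (+ 17 * x + + 2 * (+ 12 * y)) + + 3
  reduce-b = solve-∀
  regroup-C : ∀ m C → + 48 * m + + 17 * C - + 36 ≡ + 12 * (+ 4 * m) + + 17 * C - + 36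
  regroup-C = solve-∀
  reduce-C : ∀ x y → + 12 * (+ 3 * x + + 3) + + 17 * (+ 3 * y) - + 36 ≡ + 3 * (+ 12 * x + + 17 * y)
  reduce-C = solve-∀

neo-pellPoint : ∀ k → PellPoint (4 ℕ.* k) (+ neoB k) (+ neoC k)
neo-pellPoint zero    = pellPoint refl refl
neo-pellPoint (suc k) = subst (λ g → PellPoint g (+ neoB (suc k)) (+ neoC (suc k))) (sym (ℕ.*-suc 4 k))
                              (ascent-pellPoint (neo-ascent k) (neo-pellPoint k))

isNeoC⇒neoSquare : ∀ m C → IsNeoC m C → NeoSquare m C
isNeoC⇒neoSquare m C e = ℤ.+-injective (begin
  + (C ℕ.* C ℕ.+ 12 ℕ.* m)                          ≡⟨ ℤ.pos-+ (C ℕ.* C) (12 ℕ.* m) ⟩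
  + (C ℕ.* C) + + (12 ℕ.* m)                        ≡⟨ cong₂ _+_ (ℤ.pos-* C C) (ℤ.pos-* 12 m) ⟩
  + C * + C + + 12 * + m                            ≡⟨ cong (_+ + 12 * + m) e ⟩
  + 8 * + m * + m - + 12 * + m + + 9 + + 12 * + m   ≡⟨ cancel (+ m) ⟩
  + 8 * + m * + m + + 9                             ≡⟨ cong (λ x → x * + m + + 9) (ℤ.pos-* 8 m) ⟨
  + (8 ℕ.* m) * + m + + 9                           ≡⟨ cong (_+ + 9) (ℤ.pos-* (8 ℕ.* m) m) ⟨
  + (8 ℕ.* m ℕ.* m) + + 9                           ≡⟨ ℤ.pos-+ (8 ℕ.* m ℕ.* m) 9 ⟨
  + (8 ℕ.* m ℕ.* m ℕ.+ 9)                           ∎)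
  where
  cancel : ∀ m → + 8 * m * m - + 12 * m + + 9 + + 12 * m ≡ + 8 * m * m + + 9
  cancel = solve-∀

balancer-root : ∀ m r C → IsNeoBalcobalancer m r → IsNeoC m C → + C ≡ + 2 * + r + + 2 * + m + + 1
balancer-root m r C balancer root = begin
  + C                                ≡⟨ cong +_ (neoSquare-unique m (isNeoC⇒neoSquare m C root) square) ⟩
  + (2 ℕ.* r ℕ.+ 2 ℕ.* m ℕ.+ 1)      ≡⟨ ℤ.pos-+ (2 ℕ.* r ℕ.+ 2 ℕ.* m) 1 ⟩
  + (2 ℕ.* r ℕ.+ 2 ℕ.* m) + + 1      ≡⟨ cong (_+ + 1) (ℤ.pos-+ (2 ℕ.* r) (2 ℕ.* m)) ⟩
  + (2 ℕ.* r) + + (2 ℕ.* m) + + 1    ≡⟨ cong₂ (λ x y → x + y + + 1) (ℤ.pos-* 2 r) (ℤ.pos-* 2 m) ⟩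
  + 2 * + r + + 2 * + m + + 1        ∎
  where
  square = balancer⇒neoSquare m r balancer

neoBC-pellPoint : ∀ k m C → m ≡ neoB k → IsNeoC m C → PellPoint (4 ℕ.* k) (+ m) (+ C)
neoBC-pellPoint k m C refl root = subst (λ x → PellPoint (4 ℕ.* k) (+ m) (+ x)) neoC≡C (neo-pellPoint k)
  where
  neoC≡C = neoSquare-unique m (neo-square k) (isNeoC⇒neoSquare m C root)

theorem9p3 : (n : ℕ) → 1 ≤ n →
    (b r C b′ r′ C′ : ℕ) →
    IsNthNeoBC n b → IsNeoBalcobalancer b r → IsNeoC b C →
    IsNthNeoBC (n Data.Nat.+ 1) b′ → IsNeoBalcobalancer b′ r′ → IsNeoC b′ C′ →
      (+ 36 * ∑ 1 (2 Data.Nat.* n) (λ i → B (2 Data.Nat.* i Data.Nat.∸ 1))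
         ≡ (+ 20 * + b′ - + 7 * + C′ - + 15) * (+ 20 * + b′ - + 7 * + C′ - + 15))
      × (+ 9 * (+ 1 + ∑ 1 (4 Data.Nat.* n Data.Nat.+ 2) c)
         ≡ (+ 4 * + r′ + + 5) * (+ 4 * + r′ + + 5))
      × (+ 9 * (+ 1 + ∑ 1 (8 Data.Nat.* n Data.Nat.∸ 5) P)
         ≡ (- (+ 4 * + b) + + 2 * + C + + 3) * (- (+ 4 * + b) + + 2 * + C + + 3))
      × (+ 9 * ∑ 1 (4 Data.Nat.* n) (λ i → Q (2 Data.Nat.* i Data.Nat.∸ 1))
         ≡ (+ 40 * + b′ - + 14 * + C′ - + 30) * (+ 40 * + b′ - + 14 * + C′ - + 30))
      × (+ 9 * ∑ 0 (4 Data.Nat.* n) (λ i → Q (2 Data.Nat.* i Data.Nat.+ 1))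
         ≡ + 2 * ((+ 12 * + b′ - + 4 * + C′ - + 9) * (+ 12 * + b′ - + 4 * + C′ - + 9)))
theorem9p3 (suc k) _ b _ C b′ r′ C′ nth _ root nth′ balancer′ root′ =
  sum-B-identity n {+ b′} {+ C′} pt′ ,
  sum-c-identity n {+ b′} {+ r′} {+ C′} pt′ C′≡ ,
  sum-P-identity k {+ b} {+ C} pt ,
  sum-Q-identity n {+ b′} {+ C′} pt′ ,
  sum-Q′-identity n {+ b′} {+ C′} pt′
  where
  n = suc k
  pt : PellPoint (4 ℕ.* k) (+ b) (+ C)
  pt = neoBC-pellPoint k b C (nth-neoBC n b nth) root
  pt′ : PellPoint (4 ℕ.* n) (+ b′) (+ C′)
  pt′ = neoBC-pellPoint n b′ C′ (trans (nth-neoBC (n ℕ.+ 1) b′ nth′) (cong neoB (ℕ.m+n∸n≡m n 1))) root′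
  C′≡ : + C′ ≡ + 2 * + r′ + + 2 * + b′ + + 1
  C′≡ = balancer-root b′ r′ C′ balancer′ root′
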